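{- Let $\delta=(\delta_1,\ldots,\delta_\ell)$ be a composition and let $G(\delta)$ be the corresponding gate. The map $\phi$ sending a restricted ideal $\lfloor d\rfloor$ of $G(\delta)$ to the subset $\lceil e\rceil$, where $e$ is obtained from $d=(d_1,\ldots,d_\ell)$ by steps (P1) and (P2) below, is a well-defined bijection from the set of restricted ideals of $G(\delta)$ to the set of restricted filters of $G(\delta)$, and it preserves cardinality.
   Context: For a composition $\beta$ with $s$ parts, the fence $F(\beta)$ is obtained from chains $S_1,\dots,S_s$ with $\#S_i=\beta_i+1$ by identifying the maximal elements of $S_i,S_{i+1}$ for $i$ odd and the minimal elements for $i$ even. The gate is $G(\delta)=F(\delta_1,1,\delta_2,1,\ldots,1,\delta_\ell)^*$ (the order dual). Concretely, $G(\delta)$ is the disjoint union of chains $D_1,\ldots,D_\ell$ (its descending segments, left to right), where $D_i$ has $\delta_i+1$ elements, with the additional cover relations that the minimum of $D_i$ is covered by the maximum of $D_{i+1}$ for $1\le i<\ell$. For a sequence $d=(d_1,\ldots,d_\ell)$, $\lfloor d\rfloor$ denotes the subset of $G(\delta)$ consisting of the $d_i$ smallest elements of $D_i$ for each $i$, and $\lceil e\rceil$ the subset consisting of the $e_i$ largest elements of $D_i$; every lower order ideal has the form $\lfloor d\rfloor$ and every upper order ideal (filter) the form $\lceil e\rceil$. A lower order ideal $\lfloor d\rfloor$ is restricted if $d_1\le\delta_1$ and $d_\ell\neq1$. A filter $\lceil e\rceil$ is restricted if $e_1\neq1$ and $e_\ell\le\delta_\ell$. For a sequence of nonnegative integers,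 a factor is a run of consecutive entries; a block is a maximal factor of positive entries; the factor of trailing ones $T$ of a block $B$ is the maximal (possibly empty) final segment of $B$ consisting only of ones, and $B'$ denotes $B$ with $T$ removed (so $B=B'T$). The map on sequences is: (P1) for each block whose factor of trailing ones $T$ is nonempty, exchange $T$ with the entry $0$ immediately to its right (i.e. the factor $T,0$ becomes $0,T$); (P2) for each block $B$ with $\#B'\ge2$, decrease the last entry of $B'$ by $1$ and increase the first entry of $B'$ by $1$. (This map is applied only to sequences in which each nonempty $T$ is immediately followed by a $0$.) Example: $6,1,1,1,0,4,5,1,1,0,0,3,1,2\mapsto 6,0,1,1,1,5,4,0,1,1,0,4,1,1$. -}

module Defs where

open import Data.Nat using (ℕ; zero; suc; _∸_; _≤_; _<ᵇ_; _≤ᵇ_)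
open import Data.Bool using (Bool; true; false; if_then_else_)
open import Data.Fin using (Fin; toℕ)
open import Data.List using (List; []; _∷_; _++_; _∷ʳ_; length; lookup; allFin; filterᵇ; map)
open import Data.Nat.ListAction using (sum)
open import Data.List.Relation.Binary.Pointwise using (Pointwise)
open import Data.Product using (Σ; _×_; _,_; proj₁; proj₂)
open import Relation.Binary.PropositionalEquality using (_≡_; _≢_)
open import Relation.Binary.Construct.Closure.ReflexiveTransitive using (Star)
open import Relation.Nullary using (¬_)
open import Data.Nat using (_≡ᵇ_)

-- Sequences: entry at position k (0-based), 0 if out of range.

nth : List ℕ → ℕ → ℕ
nth []       _       = 0
nth (x ∷ xs) zero    = x
nth (x ∷ xs) (suc k) = nth xs k

-- An element (i , j) is the element of the chain D_{i+1} at height j,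
-- counted from the bottom: j = 0 is the minimum of D_{i+1}, j = δ_{i+1}
-- its maximum (D_{i+1} has δ_{i+1}+1 elements).

Elem : List ℕ → Set
Elem δ = Σ (Fin (length δ)) (λ i → Fin (suc (lookup δ i)))

data _⋖_ {δ : List ℕ} : Elem δ → Elem δ → Set where
  chain : ∀ {i} {j j′ : Fin (suc (lookup δ i))} →
          toℕ j′ ≡ suc (toℕ j) → _⋖_ {δ} (i , j) (i , j′)
  link  : ∀ {i i′} {j : Fin (suc (lookup δ i))} {j′ : Fin (suc (lookup δ i′))} →
          toℕ i′ ≡ suc (toℕ i) → toℕ j ≡ 0 → toℕ j′ ≡ lookup δ i′ →
          _⋖_ {δ} (i , j) (i′ , j′)

_≤G_ : {δ : List ℕ} → Elem δ → Elem δ → Set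
_≤G_ {δ} = Star (_⋖_ {δ})

Subset : List ℕ → Set
Subset δ = Elem δ → Bool

_∈_ : {δ : List ℕ} → Elem δ → Subset δ → Set
_∈_ {δ} x S = S x ≡ true

IsLowerIdeal : (δ : List ℕ) → Subset δ → Set
IsLowerIdeal δ S = ∀ (x y : Elem δ) → _≤G_ {δ} y x → _∈_ {δ} x S → _∈_ {δ} y S

IsFilter : (δ : List ℕ) → Subset δ → Set
IsFilter δ S = ∀ (x y : Elem δ) → _≤G_ {δ} x y → _∈_ {δ} x S → _∈_ {δ} y S

card : (δ : List ℕ) → Subset δ → ℕ
card δ S = sum (map (λ i → length (filterᵇ (λ j → S (i , j)) (allFin (suc (lookup δ i))))) (allFin (length δ)))

⌊_⌋ : {δ : List ℕ} → List ℕ → Subset δ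
⌊ d ⌋ (i , j) = toℕ j <ᵇ nth d (toℕ i)

⌈_⌉ : {δ : List ℕ} → List ℕ → Subset δ
⌈_⌉ {δ} e (i , j) = (suc (lookup δ i) ∸ nth e (toℕ i)) ≤ᵇ toℕ j

IsComposition : List ℕ → Set
IsComposition δ = (δ ≢ []) × (∀ k → k Data.Nat.< length δ → 1 ≤ nth δ k)

Fits : List ℕ → List ℕ → Set
Fits δ d = Pointwise (λ di δi → di ≤ suc δi) d δ

RestrictedIdeal : List ℕ → List ℕ → Set
RestrictedIdeal δ d =
  Fits δ d × IsLowerIdeal δ (⌊_⌋ {δ} d) ×
  (nth d 0 ≤ nth δ 0) × (nth d (length δ ∸ 1) ≢ 1)

RestrictedFilter : List ℕ → List ℕ → Set
RestrictedFilter δ e =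
  Fits δ e × IsFilter δ (⌈_⌉ {δ} e) ×
  (nth e 0 ≢ 1) × (nth e (length δ ∸ 1) ≤ nth δ (length δ ∸ 1))

-- splitTrail B = (B′ , #T) where B = B′ T, T the factor of trailing ones
splitTrail : List ℕ → List ℕ × ℕ
splitTrail [] = [] , 0
splitTrail (x ∷ xs) with splitTrail xs
... | [] , k = if x ≡ᵇ 1 then ([] , suc k) else ((x ∷ []) , k)
... | (b ∷ bs) , k = (x ∷ b ∷ bs) , k

replicate1 : ℕ → List ℕ
replicate1 zero    = []
replicate1 (suc k) = 1 ∷ replicate1 k

decLast : List ℕ → List ℕ
decLast []           = []
decLast (x ∷ [])     = (x ∸ 1) ∷ []
decLast (x ∷ y ∷ ys) = x ∷ decLast (y ∷ ys)

p2 : List ℕ → List ℕ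
p2 []           = []
p2 (x ∷ [])     = x ∷ []
p2 (x ∷ y ∷ ys) = suc x ∷ decLast (y ∷ ys)

blockThenZero : List ℕ → List ℕ
blockThenZero B with splitTrail B
... | B′ , k = p2 B′ ++ (0 ∷ replicate1 k)

-- a block B at the end of the sequence: output P2(B′) T
-- (for the sequences the map is applied to, T is empty here)
blockAtEnd : List ℕ → List ℕ
blockAtEnd B with splitTrail B
... | B′ , k = p2 B′ ++ replicate1 k

go : List ℕ → List ℕ → List ℕ
go blk []            = blockAtEnd blk
go blk (zero ∷ xs)   = blockThenZero blk ++ go [] xs
go blk (suc n ∷ xs)  = go (blk ∷ʳ suc n) xs

φ : List ℕ → List ℕ
φ = go []

{-# OPTIONS --safe #-}
-- Cut d at its zeros into blocks B = B′T.  On each block φ moves one unit from the end of B′ to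
-- its start and slides the ones T past the following zero; ψ undoes this piece by piece, so φ is a
-- bijection from the sequences not ending in 1 onto those not starting with 1.  Restrictedness of
-- ⌊d⌋ (resp. ⌈e⌉) is local: an entry filling its whole chain needs a nonzero left (resp. right)
-- neighbour, the boundary counting as 0.  So in a restricted ideal no block starts with a full
-- entry, and after φ raises the first and lowers the last entry of B′ no block ends with one.
-- Finally #⌊d⌋ = Σ d, #⌈e⌉ = Σ e, and φ preserves the sum.
module Submission where

open import Defs
open import Data.Bool using (Bool; true; false; if_then_else_)
open import Data.Bool.Properties using (T-≡)
open import Data.Empty using (⊥; ⊥-elim)
open import Data.Fin using (Fin; toℕ; fromℕ; fromℕ<) renaming (zero to fzero; suc to fsuc)
open import Data.Fin.Properties using (toℕ-fromℕ; toℕ-fromℕ<; toℕ<n)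
open import Data.List using (List; []; _∷_; _++_; _∷ʳ_; length; lookup; tabulate; filterᵇ; allFin)
open import Data.List.Properties using (++-assoc; ++-identityʳ; ∷ʳ-++; map-tabulate)
open import Data.List.Relation.Unary.All using (All; []; _∷_)
open import Data.List.Relation.Unary.All.Properties using (++⁺; ++⁻ˡ; ∷ʳ⁺)
open import Data.List.Relation.Binary.Pointwise using ([]; _∷_)
open import Data.List.Relation.Binary.Pointwise.Properties using (Pointwise-length)
open import Data.Nat using (ℕ; zero; suc; _+_; _∸_; _≤_; _<_; z≤n; s≤s; _<ᵇ_; _≤ᵇ_; _<?_)
open import Data.Nat.Properties
open import Data.Nat.ListAction using (sum)
open import Data.Nat.ListAction.Properties using (sum-++)
open import Data.Product using (∃; _×_; _,_; proj₁; proj₂)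
open import Data.Unit using (⊤; tt)
open import Function using (_∘_; id; _⇔_; mk⇔; Equivalence)
open import Relation.Binary.Construct.Closure.ReflexiveTransitive using (Star; ε; _◅_; fold)
open import Relation.Binary.Definitions using (_Respects_)
open import Relation.Binary.PropositionalEquality
open import Relation.Nullary using (yes; no)

open ≡-Reasoning

Positive : List ℕ → Set
Positive = All (0 <_)

LastNot1 : List ℕ → Set
LastNot1 []           = ⊤
LastNot1 (x ∷ [])     = x ≢ 1
LastNot1 (_ ∷ y ∷ ys) = LastNot1 (y ∷ ys)

HeadNot1 : List ℕ → Set
HeadNot1 e = nth e 0 ≢ 1

headOr : ℕ → List ℕ → ℕ
headOr m []      = m
headOr _ (x ∷ _) = x

lastOr : ℕ → List ℕ → ℕ
lastOr p []       = p
lastOr _ (x ∷ xs) = lastOr x xs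

HeadNot1-++⁻ : ∀ a {b} → HeadNot1 (a ++ b) → HeadNot1 a
HeadNot1-++⁻ []      _ = λ ()
HeadNot1-++⁻ (_ ∷ _) h = h

LastNot1-∷ : ∀ {y} b → y ≢ 1 → LastNot1 b → LastNot1 (y ∷ b)
LastNot1-∷ []      y≢1 _ = y≢1
LastNot1-∷ (_ ∷ _) _   l = l

LastNot1-++⁺ : ∀ a {y b} → LastNot1 (y ∷ b) → LastNot1 (a ++ y ∷ b)
LastNot1-++⁺ []          l = l
LastNot1-++⁺ (_ ∷ [])    l = l
LastNot1-++⁺ (_ ∷ x ∷ a) l = LastNot1-++⁺ (x ∷ a) l

LastNot1-++⁻ : ∀ a {y b} → LastNot1 (a ++ y ∷ b) → LastNot1 (y ∷ b)
LastNot1-++⁻ []          l = l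
LastNot1-++⁻ (_ ∷ [])    l = l
LastNot1-++⁻ (_ ∷ x ∷ a) l = LastNot1-++⁻ (x ∷ a) l

LastNot1-tail : ∀ y b → LastNot1 (y ∷ b) → LastNot1 b
LastNot1-tail _ []      _ = tt
LastNot1-tail _ (_ ∷ _) l = l

LastNot1⇔nth : ∀ d → LastNot1 d ⇔ (nth d (length d ∸ 1) ≢ 1)
LastNot1⇔nth d = mk⇔ (to d) (from d)
  where
    to : ∀ d → LastNot1 d → nth d (length d ∸ 1) ≢ 1
    to []           _ ()
    to (_ ∷ [])     l = l
    to (_ ∷ y ∷ ys) l = to (y ∷ ys) l
    from : ∀ d → nth d (length d ∸ 1) ≢ 1 → LastNot1 d
    from []           _ = tt
    from (_ ∷ [])     l = l
    from (_ ∷ y ∷ ys) l = from (y ∷ ys) l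

replicate1-∷ʳ : ∀ k xs → replicate1 (suc k) ++ xs ≡ replicate1 k ++ 1 ∷ xs
replicate1-∷ʳ zero    xs = refl
replicate1-∷ʳ (suc k) xs = cong (1 ∷_) (replicate1-∷ʳ k xs)

replicate1-positive : ∀ k → Positive (replicate1 k)
replicate1-positive zero    = []
replicate1-positive (suc k) = s≤s z≤n ∷ replicate1-positive k

splitTrail-replicate1 : ∀ k → splitTrail (replicate1 k) ≡ ([] , k)
splitTrail-replicate1 zero                                    = refl
splitTrail-replicate1 (suc k) rewrite splitTrail-replicate1 k = refl

splitTrail-++-replicate1 : ∀ a k → LastNot1 a → splitTrail (a ++ replicate1 k) ≡ (a , k)
splitTrail-++-replicate1 []                  k _ = splitTrail-replicate1 k
splitTrail-++-replicate1 (zero ∷ [])         k _ rewrite splitTrail-replicate1 k = refl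
splitTrail-++-replicate1 (suc zero ∷ [])     k l = ⊥-elim (l refl)
splitTrail-++-replicate1 (suc (suc _) ∷ [])  k _ rewrite splitTrail-replicate1 k = refl
splitTrail-++-replicate1 (_ ∷ b ∷ bs)        k l rewrite splitTrail-++-replicate1 (b ∷ bs) k l = refl

splitTrail-sound : ∀ B → let (B′ , k) = splitTrail B in (B ≡ B′ ++ replicate1 k) × LastNot1 B′
splitTrail-sound [] = refl , tt
splitTrail-sound (x ∷ xs) with splitTrail xs | splitTrail-sound xs
splitTrail-sound (zero ∷ xs)        | [] , k     | eq , _ = cong (0 ∷_) eq , λ ()
splitTrail-sound (suc zero ∷ xs)    | [] , k     | eq , _ = cong (1 ∷_) eq , tt
splitTrail-sound (suc (suc n) ∷ xs) | [] , k     | eq , _ = cong (suc (suc n) ∷_) eq , λ ()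
splitTrail-sound (x ∷ xs)           | _ ∷ _ , k  | eq , l = cong (x ∷_) eq , l

blockThenZero-split : ∀ A k → LastNot1 A → blockThenZero (A ++ replicate1 k) ≡ p2 A ++ 0 ∷ replicate1 k
blockThenZero-split A k l with splitTrail (A ++ replicate1 k) | splitTrail-++-replicate1 A k l
... | _ | refl = refl

blockAtEnd-split : ∀ A k → LastNot1 A → blockAtEnd (A ++ replicate1 k) ≡ p2 A ++ replicate1 k
blockAtEnd-split A k l with splitTrail (A ++ replicate1 k) | splitTrail-++-replicate1 A k l
... | _ | refl = refl

record TrailingOnes (B : List ℕ) : Set where
  field
    B′       : List ℕ
    t        : ℕ
    B≡B′T    : B ≡ B′ ++ replicate1 t
    B′-last  : LastNot1 B′
    B′-pos   : Positive B′

  thenZero : blockThenZero B ≡ p2 B′ ++ 0 ∷ replicate1 t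
  thenZero = trans (cong blockThenZero B≡B′T) (blockThenZero-split B′ t B′-last)

  atEnd : blockAtEnd B ≡ p2 B′ ++ replicate1 t
  atEnd = trans (cong blockAtEnd B≡B′T) (blockAtEnd-split B′ t B′-last)

trailingOnes : ∀ {B} → Positive B → TrailingOnes B
trailingOnes {B} pB = record
  { B′ = proj₁ (splitTrail B) ; t = proj₂ (splitTrail B)
  ; B≡B′T = proj₁ (splitTrail-sound B) ; B′-last = proj₂ (splitTrail-sound B)
  ; B′-pos = ++⁻ˡ _ (subst Positive (proj₁ (splitTrail-sound B)) pB) }

data Blocks : List ℕ → Set where
  lastBlock : ∀ {B} → Positive B → Blocks B
  block     : ∀ {B r} → Positive B → Blocks r → Blocks (B ++ 0 ∷ r)

blocks : ∀ d → Blocks d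
blocks []          = lastBlock []
blocks (zero ∷ r)  = block [] (blocks r)
blocks (suc n ∷ r) with blocks r
... | lastBlock pB = lastBlock (s≤s z≤n ∷ pB)
... | block pB v   = block (s≤s z≤n ∷ pB) v

go-block : ∀ blk {A} r → Positive A → go blk (A ++ 0 ∷ r) ≡ blockThenZero (blk ++ A) ++ go [] r
go-block blk r [] = cong (λ z → blockThenZero z ++ go [] r) (sym (++-identityʳ blk))
go-block blk {suc n ∷ A} r (_ ∷ pA) =
  trans (go-block (blk ∷ʳ suc n) r pA) (cong (λ z → blockThenZero z ++ go [] r) (∷ʳ-++ blk (suc n) A))

go-lastBlock : ∀ blk {A} → Positive A → go blk A ≡ blockAtEnd (blk ++ A)
go-lastBlock blk [] = cong blockAtEnd (sym (++-identityʳ blk))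
go-lastBlock blk {suc n ∷ A} (_ ∷ pA) =
  trans (go-lastBlock (blk ∷ʳ suc n) pA) (cong blockAtEnd (∷ʳ-++ blk (suc n) A))

φ-block : ∀ {B} r → Positive B → φ (B ++ 0 ∷ r) ≡ blockThenZero B ++ φ r
φ-block = go-block []

φ-lastBlock : ∀ {B} → Positive B → φ B ≡ blockAtEnd B
φ-lastBlock = go-lastBlock []

φ-lastBlock-noTrail : ∀ {B} → Positive B → LastNot1 B → φ B ≡ p2 B
φ-lastBlock-noTrail {B} pB l = begin
  φ B                        ≡⟨ φ-lastBlock pB ⟩
  blockAtEnd B               ≡⟨ cong blockAtEnd (sym (++-identityʳ B)) ⟩
  blockAtEnd (B ++ [])       ≡⟨ blockAtEnd-split B 0 l ⟩
  p2 B ++ []                 ≡⟨ ++-identityʳ (p2 B) ⟩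
  p2 B                       ∎

incLast : List ℕ → List ℕ
incLast []           = []
incLast (x ∷ [])     = suc x ∷ []
incLast (x ∷ y ∷ ys) = x ∷ incLast (y ∷ ys)

p2⁻¹ : List ℕ → List ℕ
p2⁻¹ []           = []
p2⁻¹ (x ∷ [])     = x ∷ []
p2⁻¹ (x ∷ y ∷ ys) = (x ∸ 1) ∷ incLast (y ∷ ys)

incLast-decLast : ∀ {l} → Positive l → incLast (decLast l) ≡ l
incLast-decLast []                                   = refl
incLast-decLast (s≤s _ ∷ [])                         = refl
incLast-decLast (_ ∷ s≤s _ ∷ [])                     = refl
incLast-decLast {x ∷ _ ∷ _ ∷ _} (_ ∷ p@(_ ∷ _ ∷ _))  = cong (x ∷_) (incLast-decLast p)

decLast-incLast : ∀ l → decLast (incLast l) ≡ l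
decLast-incLast []               = refl
decLast-incLast (x ∷ [])         = refl
decLast-incLast (x ∷ y ∷ [])     = refl
decLast-incLast (x ∷ y ∷ z ∷ zs) = cong (x ∷_) (decLast-incLast (y ∷ z ∷ zs))

p2⁻¹-p2 : ∀ {B} → Positive B → p2⁻¹ (p2 B) ≡ B
p2⁻¹-p2 []                    = refl
p2⁻¹-p2 (_ ∷ [])              = refl
p2⁻¹-p2 {x ∷ y ∷ ys} (_ ∷ p) with decLast (y ∷ ys) | incLast-decLast p
... | _ ∷ _ | eq = cong (x ∷_) eq

p2-p2⁻¹ : ∀ {C} → Positive C → p2 (p2⁻¹ C) ≡ C
p2-p2⁻¹ []                            = refl
p2-p2⁻¹ (_ ∷ [])                      = refl
p2-p2⁻¹ {suc x ∷ y ∷ ys} (s≤s _ ∷ _) with incLast (y ∷ ys) | decLast-incLast (y ∷ ys)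
... | _ ∷ _ | eq = cong (suc x ∷_) eq

decLast-positive : ∀ {l} → Positive l → LastNot1 l → Positive (decLast l)
decLast-positive []                          _ = []
decLast-positive {suc zero ∷ []} _           l = ⊥-elim (l refl)
decLast-positive {suc (suc _) ∷ []} _        _ = s≤s z≤n ∷ []
decLast-positive {_ ∷ _ ∷ _} (p ∷ ps)        l = p ∷ decLast-positive ps l

p2-positive : ∀ {B} → Positive B → LastNot1 B → Positive (p2 B)
p2-positive []             _ = []
p2-positive (p ∷ [])       _ = p ∷ []
p2-positive (_ ∷ p ∷ ps)   l = s≤s z≤n ∷ decLast-positive (p ∷ ps) l

incLast-positive : ∀ {l} → Positive l → Positive (incLast l)
incLast-positive []           = []
incLast-positive (_ ∷ [])     = s≤s z≤n ∷ []
incLast-positive (p ∷ q ∷ ps) = p ∷ incLast-positive (q ∷ ps)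

p2⁻¹-positive : ∀ {C} → Positive C → HeadNot1 C → Positive (p2⁻¹ C)
p2⁻¹-positive []                              _ = []
p2⁻¹-positive (p ∷ [])                        _ = p ∷ []
p2⁻¹-positive {suc zero ∷ _ ∷ _} _            h = ⊥-elim (h refl)
p2⁻¹-positive {suc (suc _) ∷ _ ∷ _} (_ ∷ ps)  _ = s≤s z≤n ∷ incLast-positive ps

LastNot1-∷-incLast : ∀ x {y ys} → Positive (y ∷ ys) → LastNot1 (x ∷ incLast (y ∷ ys))
LastNot1-∷-incLast x (s≤s _ ∷ [])          = λ ()
LastNot1-∷-incLast x {y} (_ ∷ ps@(_ ∷ _))  = LastNot1-∷-incLast y ps

p2⁻¹-last : ∀ {C} → Positive C → HeadNot1 C → LastNot1 (p2⁻¹ C)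
p2⁻¹-last []                   _ = tt
p2⁻¹-last (_ ∷ [])             h = h
p2⁻¹-last {x ∷ _ ∷ _} (_ ∷ ps) _ = LastNot1-∷-incLast (x ∸ 1) ps

p2-head : ∀ {B} X → Positive B → LastNot1 B → HeadNot1 X → HeadNot1 (p2 B ++ X)
p2-head X []               _ h  = h
p2-head X (_ ∷ [])         l _  = l
p2-head X (s≤s _ ∷ _ ∷ _)  _ _  = λ ()

-- ψ-ones C t xs has read the block C, a zero and t ones; it returns the ones in front of the zero.
mutual
  ψ-go : List ℕ → List ℕ → List ℕ
  ψ-go C []           = p2⁻¹ C
  ψ-go C (zero ∷ xs)  = ψ-ones C 0 xs
  ψ-go C (suc n ∷ xs) = ψ-go (C ∷ʳ suc n) xs

  ψ-ones : List ℕ → ℕ → List ℕ → List ℕ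
  ψ-ones C t []                 = (p2⁻¹ C ++ replicate1 t) ++ 0 ∷ []
  ψ-ones C t (zero ∷ xs)        = (p2⁻¹ C ++ replicate1 t) ++ 0 ∷ ψ-ones [] 0 xs
  ψ-ones C t (suc zero ∷ xs)    = ψ-ones C (suc t) xs
  ψ-ones C t (suc (suc n) ∷ xs) = (p2⁻¹ C ++ replicate1 t) ++ 0 ∷ ψ-go (suc (suc n) ∷ []) xs

ψ : List ℕ → List ℕ
ψ = ψ-go []

data Pieces : List ℕ → Set where
  lastPiece : ∀ {C} → Positive C → Pieces C
  piece     : ∀ {C r} k → Positive C → HeadNot1 r → Pieces r → Pieces (C ++ 0 ∷ replicate1 k ++ r)

mutual
  pieces-go : ∀ {C} → Positive C → ∀ xs → Pieces (C ++ xs)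
  pieces-go {C} pC []       = subst Pieces (sym (++-identityʳ C)) (lastPiece pC)
  pieces-go pC (zero ∷ xs)  = pieces-ones pC 0 xs
  pieces-go {C} pC (suc n ∷ xs) =
    subst Pieces (∷ʳ-++ C (suc n) xs) (pieces-go (∷ʳ⁺ pC (s≤s z≤n)) xs)

  pieces-ones : ∀ {C} → Positive C → ∀ k xs → Pieces (C ++ 0 ∷ replicate1 k ++ xs)
  pieces-ones pC k []                 = piece k pC (λ ()) (lastPiece [])
  pieces-ones pC k (zero ∷ xs)        = piece k pC (λ ()) (pieces-ones [] 0 xs)
  pieces-ones {C} pC k (suc zero ∷ xs) =
    subst (λ z → Pieces (C ++ 0 ∷ z)) (replicate1-∷ʳ k xs) (pieces-ones pC (suc k) xs)
  pieces-ones pC k (suc (suc n) ∷ xs) = piece k pC (λ ()) (pieces-go (s≤s z≤n ∷ []) xs)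

pieces : ∀ e → Pieces e
pieces = pieces-go []

ψ-go-++ : ∀ C {A} xs → Positive A → ψ-go C (A ++ xs) ≡ ψ-go (C ++ A) xs
ψ-go-++ C xs [] = cong (λ z → ψ-go z xs) (sym (++-identityʳ C))
ψ-go-++ C {suc n ∷ A} xs (_ ∷ pA) =
  trans (ψ-go-++ (C ∷ʳ suc n) xs pA) (cong (λ z → ψ-go z xs) (∷ʳ-++ C (suc n) A))

ψ-ones-replicate1 : ∀ C t k r → ψ-ones C t (replicate1 k ++ r) ≡ ψ-ones C (t + k) r
ψ-ones-replicate1 C t zero    r = cong (λ z → ψ-ones C z r) (sym (+-identityʳ t))
ψ-ones-replicate1 C t (suc k) r =
  trans (ψ-ones-replicate1 C (suc t) k r) (cong (λ z → ψ-ones C z r) (sym (+-suc t k)))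

ψ-ones-headNot1 : ∀ C t r → HeadNot1 r → ψ-ones C t r ≡ (p2⁻¹ C ++ replicate1 t) ++ 0 ∷ ψ r
ψ-ones-headNot1 C t []                 _ = refl
ψ-ones-headNot1 C t (zero ∷ _)         _ = refl
ψ-ones-headNot1 C t (suc zero ∷ _)     h = ⊥-elim (h refl)
ψ-ones-headNot1 C t (suc (suc _) ∷ _)  _ = refl

ψ-piece : ∀ {C} k {r} → Positive C → HeadNot1 r →
  ψ (C ++ 0 ∷ replicate1 k ++ r) ≡ (p2⁻¹ C ++ replicate1 k) ++ 0 ∷ ψ r
ψ-piece {C} k {r} pC hr = begin
  ψ (C ++ 0 ∷ replicate1 k ++ r)        ≡⟨ ψ-go-++ [] (0 ∷ replicate1 k ++ r) pC ⟩
  ψ-ones C 0 (replicate1 k ++ r)         ≡⟨ ψ-ones-replicate1 C 0 k r ⟩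
  ψ-ones C k r                           ≡⟨ ψ-ones-headNot1 C k r hr ⟩
  (p2⁻¹ C ++ replicate1 k) ++ 0 ∷ ψ r   ∎

ψ-lastPiece : ∀ {C} → Positive C → ψ C ≡ p2⁻¹ C
ψ-lastPiece {C} pC = trans (cong ψ (sym (++-identityʳ C))) (ψ-go-++ [] [] pC)

φ-headNot1 : ∀ {d} → Blocks d → LastNot1 d → HeadNot1 (φ d)
φ-headNot1 (block {B} {r} pB _) _ = subst HeadNot1 (sym φd≡) (p2-head _ B′-pos B′-last (λ ()))
  where
    open TrailingOnes (trailingOnes pB)
    φd≡ : φ (B ++ 0 ∷ r) ≡ p2 B′ ++ 0 ∷ replicate1 t ++ φ r
    φd≡ = trans (φ-block r pB) (trans (cong (_++ φ r) thenZero) (++-assoc (p2 B′) _ (φ r)))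
φ-headNot1 (lastBlock {B} pB) l = subst HeadNot1 (sym (φ-lastBlock-noTrail pB l))
  (subst HeadNot1 (++-identityʳ (p2 B)) (p2-head [] pB l (λ ())))

ψ-φ : ∀ {d} → Blocks d → LastNot1 d → ψ (φ d) ≡ d
ψ-φ (block {B} {r} pB v) l = begin
  ψ (φ (B ++ 0 ∷ r))
    ≡⟨ cong ψ (φ-block r pB) ⟩
  ψ (blockThenZero B ++ φ r)
    ≡⟨ cong (λ z → ψ (z ++ φ r)) thenZero ⟩
  ψ ((p2 B′ ++ 0 ∷ replicate1 t) ++ φ r)
    ≡⟨ cong ψ (++-assoc (p2 B′) (0 ∷ replicate1 t) (φ r)) ⟩
  ψ (p2 B′ ++ 0 ∷ replicate1 t ++ φ r)
    ≡⟨ ψ-piece t (p2-positive B′-pos B′-last) (φ-headNot1 v lr) ⟩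
  (p2⁻¹ (p2 B′) ++ replicate1 t) ++ 0 ∷ ψ (φ r)
    ≡⟨ cong₂ (λ a b → (a ++ replicate1 t) ++ 0 ∷ b) (p2⁻¹-p2 B′-pos) (ψ-φ v lr) ⟩
  (B′ ++ replicate1 t) ++ 0 ∷ r
    ≡⟨ cong (_++ 0 ∷ r) B≡B′T ⟨
  B ++ 0 ∷ r
    ∎
  where
    open TrailingOnes (trailingOnes pB)
    lr : LastNot1 r
    lr = LastNot1-tail 0 r (LastNot1-++⁻ B l)
ψ-φ (lastBlock {B} pB) l = begin
  ψ (φ B)       ≡⟨ cong ψ (φ-lastBlock-noTrail pB l) ⟩
  ψ (p2 B)      ≡⟨ ψ-lastPiece (p2-positive pB l) ⟩
  p2⁻¹ (p2 B)   ≡⟨ p2⁻¹-p2 pB ⟩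
  B             ∎

φ-ψ : ∀ {e} → Pieces e → HeadNot1 e → φ (ψ e) ≡ e
φ-ψ (piece {C} {r} k pC hr v) h = begin
  φ (ψ (C ++ 0 ∷ replicate1 k ++ r))
    ≡⟨ cong φ (ψ-piece k pC hr) ⟩
  φ ((p2⁻¹ C ++ replicate1 k) ++ 0 ∷ ψ r)
    ≡⟨ φ-block (ψ r) (++⁺ pC′ (replicate1-positive k)) ⟩
  blockThenZero (p2⁻¹ C ++ replicate1 k) ++ φ (ψ r)
    ≡⟨ cong (_++ φ (ψ r)) (blockThenZero-split (p2⁻¹ C) k (p2⁻¹-last pC hC)) ⟩
  (p2 (p2⁻¹ C) ++ 0 ∷ replicate1 k) ++ φ (ψ r)
    ≡⟨ cong₂ (λ a b → (a ++ 0 ∷ replicate1 k) ++ b) (p2-p2⁻¹ pC) (φ-ψ v hr) ⟩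
  (C ++ 0 ∷ replicate1 k) ++ r
    ≡⟨ ++-assoc C (0 ∷ replicate1 k) r ⟩
  C ++ 0 ∷ replicate1 k ++ r
    ∎
  where
    hC : HeadNot1 C
    hC = HeadNot1-++⁻ C h
    pC′ : Positive (p2⁻¹ C)
    pC′ = p2⁻¹-positive pC hC
φ-ψ (lastPiece {C} pC) h = begin
  φ (ψ C)          ≡⟨ cong φ (ψ-lastPiece pC) ⟩
  φ (p2⁻¹ C)       ≡⟨ φ-lastBlock-noTrail (p2⁻¹-positive pC h) (p2⁻¹-last pC h) ⟩
  p2 (p2⁻¹ C)      ≡⟨ p2-p2⁻¹ pC ⟩
  C                ∎

-- The minimum of Dᵢ is covered by the maximum of Dᵢ₊₁, so ⌊d⌋ is an ideal iff a full
-- dᵢ₊₁ = δᵢ₊₁ + 1 forces dᵢ ≠ 0, and ⌈e⌉ a filter iff a full eᵢ forces eᵢ₊₁ ≠ 0.  Slot g y n says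
-- this for an entry y of a chain with δᵢ = g and relevant neighbour n.  In IdealSeq p and
-- FilterSeq m, p and m are the neighbours beyond the ends; 0 there encodes d₁ ≤ δ₁ resp. e_ℓ ≤ δ_ℓ.
Slot : ℕ → ℕ → ℕ → Set
Slot g y n = 0 < g × y ≤ suc g × (y ≡ suc g → n ≢ 0)

IdealSeq : ℕ → List ℕ → List ℕ → Set
IdealSeq p []      []      = ⊤
IdealSeq p (g ∷ Γ) (y ∷ d) = Slot g y p × IdealSeq y Γ d
IdealSeq _ _       _       = ⊥

FilterSeq : ℕ → List ℕ → List ℕ → Set
FilterSeq m []      []      = ⊤
FilterSeq m (g ∷ Γ) (y ∷ e) = Slot g y (headOr m e) × FilterSeq m Γ e
FilterSeq _ _       _       = ⊥

Slot-notFull : ∀ {g y n} → 0 < g → y ≤ g → Slot g y n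
Slot-notFull 0<g y≤g = 0<g , m≤n⇒m≤1+n y≤g , λ y≡ → ⊥-elim (<-irrefl y≡ (s≤s y≤g))

Slot-nonzero : ∀ {g y n} → 0 < g → y ≤ suc g → 0 < n → Slot g y n
Slot-nonzero 0<g y≤ 0<n = 0<g , y≤ , λ _ → m<n⇒n≢0 0<n

Slot-zeroNeighbour : ∀ {g y} → Slot g y 0 → y ≤ g
Slot-zeroNeighbour (_ , y≤ , full) = ≤-pred (≤∧≢⇒< y≤ λ y≡ → full y≡ refl)

Slot-pred : ∀ {g y n n′} → Slot g y n → Slot g (y ∸ 1) n′
Slot-pred (0<g , y≤ , _) = Slot-notFull 0<g (∸-monoˡ-≤ 1 y≤)

Slot-suc : ∀ {g y n} → Slot g y 0 → 0 < n → Slot g (suc y) n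
Slot-suc s@(0<g , _ , _) 0<n = Slot-nonzero 0<g (s≤s (Slot-zeroNeighbour s)) 0<n

IdealSeq-++⁺ : ∀ {p Γ₁ Γ₂} a {b} → IdealSeq p Γ₁ a → IdealSeq (lastOr p a) Γ₂ b →
  IdealSeq p (Γ₁ ++ Γ₂) (a ++ b)
IdealSeq-++⁺ {Γ₁ = []}    []      _          h = h
IdealSeq-++⁺ {Γ₁ = _ ∷ _} (_ ∷ a) (s , h₁) h = s , IdealSeq-++⁺ a h₁ h

IdealSeq-++⁻ : ∀ {p} Γ a {b} → IdealSeq p Γ (a ++ b) →
  ∃ λ Γ₁ → ∃ λ Γ₂ → Γ ≡ Γ₁ ++ Γ₂ × IdealSeq p Γ₁ a × IdealSeq (lastOr p a) Γ₂ b
IdealSeq-++⁻ Γ       []      h       = [] , Γ , refl , tt , h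
IdealSeq-++⁻ (g ∷ Γ) (_ ∷ a) (s , h) with IdealSeq-++⁻ Γ a h
... | Γ₁ , Γ₂ , refl , h₁ , h₂ = g ∷ Γ₁ , Γ₂ , refl , (s , h₁) , h₂

headOr-++ : ∀ m a b → headOr (headOr m b) a ≡ headOr m (a ++ b)
headOr-++ m []      b = refl
headOr-++ m (_ ∷ _) b = refl

FilterSeq-++⁺ : ∀ {m Γ₁ Γ₂} a {b} → FilterSeq (headOr m b) Γ₁ a → FilterSeq m Γ₂ b →
  FilterSeq m (Γ₁ ++ Γ₂) (a ++ b)
FilterSeq-++⁺ {Γ₁ = []}    []      _        h = h
FilterSeq-++⁺ {m} {Γ₁ = _ ∷ _} (_ ∷ a) {b} (s , h₁) h =
  subst (Slot _ _) (headOr-++ m a b) s , FilterSeq-++⁺ a h₁ h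

FilterSeq-++⁻ : ∀ {m} Γ a {b} → FilterSeq m Γ (a ++ b) →
  ∃ λ Γ₁ → ∃ λ Γ₂ → Γ ≡ Γ₁ ++ Γ₂ × FilterSeq (headOr m b) Γ₁ a × FilterSeq m Γ₂ b
FilterSeq-++⁻ Γ       []      h       = [] , Γ , refl , tt , h
FilterSeq-++⁻ {m} (g ∷ Γ) (_ ∷ a) {b} (s , h) with FilterSeq-++⁻ Γ a h
... | Γ₁ , Γ₂ , refl , h₁ , h₂ =
  g ∷ Γ₁ , Γ₂ , refl , (subst (Slot _ _) (sym (headOr-++ m a b)) s , h₁) , h₂

decLast-head : ∀ {w ws} m → Positive (w ∷ ws) → LastNot1 (w ∷ ws) → 0 < headOr m (decLast (w ∷ ws))
decLast-head {suc zero}    {[]}    _ _       l = ⊥-elim (l refl)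
decLast-head {suc (suc _)} {[]}    _ _       _ = s≤s z≤n
decLast-head {ws = _ ∷ _}          _ (p ∷ _) _ = p

decLast-FilterSeq : ∀ {p Γ} l m → Positive l → LastNot1 l → IdealSeq p Γ l → FilterSeq m Γ (decLast l)
decLast-FilterSeq {Γ = []}         []           _ _ _ _ = tt
decLast-FilterSeq {Γ = _ ∷ []}     (_ ∷ [])     _ _ _ (s , _) = Slot-pred s , tt
decLast-FilterSeq {Γ = _ ∷ _ ∷ _}  (_ ∷ w ∷ ws) m (_ ∷ p) l ((0<g , y≤ , _) , h) =
  Slot-nonzero 0<g y≤ (decLast-head m p l) , decLast-FilterSeq (w ∷ ws) m p l h

p2-FilterSeq : ∀ {Γ} B m → Positive B → LastNot1 B → IdealSeq 0 Γ B → FilterSeq m Γ (p2 B)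
p2-FilterSeq {[]}        []           _ _ _ _ = tt
p2-FilterSeq {_ ∷ []}    (_ ∷ [])     _ _ _ (s@(0<g , _ , _) , _) = Slot-notFull 0<g (Slot-zeroNeighbour s) , tt
p2-FilterSeq {_ ∷ _ ∷ _} (_ ∷ z ∷ zs) m (_ ∷ p) l (s , h) =
  Slot-suc s (decLast-head m p l) , decLast-FilterSeq (z ∷ zs) m p l h

replicate1-FilterSeq : ∀ {p Γ} k m → IdealSeq p Γ (replicate1 k) → FilterSeq m Γ (replicate1 k)
replicate1-FilterSeq {Γ = []}    zero    _ _               = tt
replicate1-FilterSeq {Γ = _ ∷ _} (suc k) m ((0<g , _) , h) = Slot-notFull 0<g 0<g , replicate1-FilterSeq k m h

shiftOnes-FilterSeq : ∀ {p Λ x y} k m → IdealSeq p Λ (replicate1 k) → 0 < x → y ≤ 1 →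
  FilterSeq m (Λ ∷ʳ x) (y ∷ replicate1 k)
shiftOnes-FilterSeq {Λ = []}    zero    m _               0<x y≤1 = Slot-notFull 0<x (≤-trans y≤1 0<x) , tt
shiftOnes-FilterSeq {Λ = _ ∷ _} (suc k) m ((0<g , _) , h) 0<x y≤1 =
  Slot-notFull 0<g (≤-trans y≤1 0<g) , shiftOnes-FilterSeq k m h 0<x ≤-refl

module _ {B} (pB : Positive B) where
  open TrailingOnes (trailingOnes pB)

  blockThenZero-FilterSeq : ∀ {Γ x} m → IdealSeq 0 Γ B → 0 < x → FilterSeq m (Γ ∷ʳ x) (blockThenZero B)
  blockThenZero-FilterSeq {Γ} {x} m h 0<x with IdealSeq-++⁻ Γ B′ (subst (IdealSeq 0 Γ) B≡B′T h)
  ... | Γ₁ , Γ₂ , refl , h₁ , h₂ = subst₂ (FilterSeq m) (sym (++-assoc Γ₁ Γ₂ (x ∷ []))) (sym thenZero)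
    (FilterSeq-++⁺ (p2 B′) (p2-FilterSeq B′ 0 B′-pos B′-last h₁) (shiftOnes-FilterSeq t m h₂ 0<x z≤n))

  blockAtEnd-FilterSeq : ∀ {Γ} m → IdealSeq 0 Γ B → FilterSeq m Γ (blockAtEnd B)
  blockAtEnd-FilterSeq {Γ} m h with IdealSeq-++⁻ Γ B′ (subst (IdealSeq 0 Γ) B≡B′T h)
  ... | Γ₁ , Γ₂ , refl , h₁ , h₂ = subst (FilterSeq m (Γ₁ ++ Γ₂)) (sym atEnd)
    (FilterSeq-++⁺ (p2 B′) (p2-FilterSeq B′ _ B′-pos B′-last h₁) (replicate1-FilterSeq t m h₂))

φ-FilterSeq : ∀ {d Γ} → Blocks d → IdealSeq 0 Γ d → FilterSeq 0 Γ (φ d)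
φ-FilterSeq {Γ = Γ} (block {B} {r} pB v) h with IdealSeq-++⁻ Γ B h
... | Γ₁ , []     , refl , _  , ()
... | Γ₁ , x ∷ Γ₂ , refl , h₁ , ((0<x , _) , h₂) =
  subst₂ (FilterSeq 0) (++-assoc Γ₁ (x ∷ []) Γ₂) (sym (φ-block r pB))
    (FilterSeq-++⁺ (blockThenZero B) (blockThenZero-FilterSeq pB _ h₁ 0<x) (φ-FilterSeq v h₂))
φ-FilterSeq (lastBlock pB) h = subst (FilterSeq 0 _) (sym (φ-lastBlock pB)) (blockAtEnd-FilterSeq pB 0 h)

incLast-IdealSeq : ∀ {p Γ} l → 0 < p → Positive l → FilterSeq 0 Γ l → IdealSeq p Γ (incLast l)
incLast-IdealSeq {Γ = []}        []           _   _       _ = tt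
incLast-IdealSeq {Γ = _ ∷ []}    (_ ∷ [])     0<p _       (s , _) = Slot-suc s 0<p , tt
incLast-IdealSeq {Γ = _ ∷ _ ∷ _} (_ ∷ w ∷ ws) 0<p (q ∷ ps) ((0<g , y≤ , _) , h) =
  Slot-nonzero 0<g y≤ 0<p , incLast-IdealSeq (w ∷ ws) q ps h

p2⁻¹-IdealSeq : ∀ {Γ} C → Positive C → HeadNot1 C → FilterSeq 0 Γ C → IdealSeq 0 Γ (p2⁻¹ C)
p2⁻¹-IdealSeq {[]}        []                       _        _ _ = tt
p2⁻¹-IdealSeq {_ ∷ []}    (_ ∷ [])                 _        _ h = h
p2⁻¹-IdealSeq {_ ∷ _ ∷ _} (zero ∷ _ ∷ _)           (() ∷ _) _ _
p2⁻¹-IdealSeq {_ ∷ _ ∷ _} (suc zero ∷ _ ∷ _)       _        h _ = ⊥-elim (h refl)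
p2⁻¹-IdealSeq {_ ∷ _ ∷ _} (suc (suc _) ∷ c ∷ cs)   (_ ∷ ps) _ (s , h) =
  Slot-pred s , incLast-IdealSeq (c ∷ cs) (s≤s z≤n) ps h

shiftOnes-IdealSeq : ∀ {p Λ x} k m → FilterSeq m Λ (replicate1 k) → 0 < x →
  IdealSeq p (x ∷ Λ) (replicate1 k ++ 0 ∷ [])
shiftOnes-IdealSeq {Λ = []}    zero    _ _               0<x = Slot-notFull 0<x z≤n , tt
shiftOnes-IdealSeq {Λ = _ ∷ _} (suc k) m ((0<g , _) , h) 0<x = Slot-notFull 0<x 0<x , shiftOnes-IdealSeq k m h 0<g

lastOr-replicate1-0 : ∀ p k → lastOr p (replicate1 k ++ 0 ∷ []) ≡ 0
lastOr-replicate1-0 p zero    = refl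
lastOr-replicate1-0 p (suc k) = lastOr-replicate1-0 1 k

ψ-IdealSeq : ∀ {e Γ} → Pieces e → HeadNot1 e → FilterSeq 0 Γ e → IdealSeq 0 Γ (ψ e)
ψ-IdealSeq {Γ = Γ} (piece {C} {r} k pC hr v) he h with FilterSeq-++⁻ Γ C h
... | Γ₁ , []     , refl , _  , ()
... | Γ₁ , x ∷ Γ₃ , refl , h₁ , ((0<x , _) , h₃) with FilterSeq-++⁻ Γ₃ (replicate1 k) h₃
... | Γ₄ , Γ₅ , refl , h₄ , h₅ = subst (IdealSeq 0 (Γ₁ ++ x ∷ Γ₄ ++ Γ₅)) (sym ψe≡)
  (IdealSeq-++⁺ (p2⁻¹ C) (p2⁻¹-IdealSeq C pC hC h₁)
    (IdealSeq-++⁺ (replicate1 k ++ 0 ∷ []) (shiftOnes-IdealSeq k _ h₄ 0<x)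
      (subst (λ p → IdealSeq p Γ₅ (ψ r)) (sym (lastOr-replicate1-0 _ k)) (ψ-IdealSeq v hr h₅))))
  where
    hC : HeadNot1 C
    hC = HeadNot1-++⁻ C he
    ψe≡ : ψ (C ++ 0 ∷ replicate1 k ++ r) ≡ p2⁻¹ C ++ (replicate1 k ++ 0 ∷ []) ++ ψ r
    ψe≡ = begin
      ψ (C ++ 0 ∷ replicate1 k ++ r)
        ≡⟨ ψ-piece k pC hr ⟩
      (p2⁻¹ C ++ replicate1 k) ++ 0 ∷ ψ r
        ≡⟨ ++-assoc (p2⁻¹ C) (replicate1 k) (0 ∷ ψ r) ⟩
      p2⁻¹ C ++ replicate1 k ++ 0 ∷ ψ r
        ≡⟨ cong (p2⁻¹ C ++_) (++-assoc (replicate1 k) (0 ∷ []) (ψ r)) ⟨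
      p2⁻¹ C ++ (replicate1 k ++ 0 ∷ []) ++ ψ r
        ∎
ψ-IdealSeq (lastPiece {C} pC) he h = subst (IdealSeq 0 _) (sym (ψ-lastPiece pC)) (p2⁻¹-IdealSeq C pC he h)

ψ-last : ∀ {e} → Pieces e → HeadNot1 e → LastNot1 (ψ e)
ψ-last (piece {C} {r} k pC hr v) _ = subst LastNot1 (sym (ψ-piece k pC hr))
  (LastNot1-++⁺ (p2⁻¹ C ++ replicate1 k) (LastNot1-∷ (ψ r) (λ ()) (ψ-last v hr)))
ψ-last (lastPiece pC) he = subst LastNot1 (sym (ψ-lastPiece pC)) (p2⁻¹-last pC he)

sum-decLast : ∀ {y ys} → Positive (y ∷ ys) → suc (sum (decLast (y ∷ ys))) ≡ sum (y ∷ ys)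
sum-decLast (s≤s _ ∷ [])         = refl
sum-decLast {y} (_ ∷ p@(_ ∷ _)) = trans (sym (+-suc y _)) (cong (y +_) (sum-decLast p))

sum-p2 : ∀ {B} → Positive B → sum (p2 B) ≡ sum B
sum-p2 []                  = refl
sum-p2 (_ ∷ [])            = refl
sum-p2 {x ∷ _} (_ ∷ p@(_ ∷ _)) = trans (sym (+-suc x _)) (cong (x +_) (sum-decLast p))

module _ {B} (pB : Positive B) where
  open TrailingOnes (trailingOnes pB)

  sum-p2B′-++ : ∀ {X} → sum X ≡ sum (replicate1 t) → sum (p2 B′ ++ X) ≡ sum B
  sum-p2B′-++ {X} sX = begin
    sum (p2 B′ ++ X)              ≡⟨ sum-++ (p2 B′) X ⟩
    sum (p2 B′) + sum X           ≡⟨ cong₂ _+_ (sum-p2 B′-pos) sX ⟩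
    sum B′ + sum (replicate1 t)   ≡⟨ sum-++ B′ (replicate1 t) ⟨
    sum (B′ ++ replicate1 t)      ≡⟨ cong sum B≡B′T ⟨
    sum B                         ∎

  sum-blockThenZero : sum (blockThenZero B) ≡ sum B
  sum-blockThenZero = trans (cong sum thenZero) (sum-p2B′-++ refl)

  sum-blockAtEnd : sum (blockAtEnd B) ≡ sum B
  sum-blockAtEnd = trans (cong sum atEnd) (sum-p2B′-++ refl)

sum-φ : ∀ {d} → Blocks d → sum (φ d) ≡ sum d
sum-φ (block {B} {r} pB v) = begin
  sum (φ (B ++ 0 ∷ r))                   ≡⟨ cong sum (φ-block r pB) ⟩
  sum (blockThenZero B ++ φ r)           ≡⟨ sum-++ (blockThenZero B) (φ r) ⟩
  sum (blockThenZero B) + sum (φ r)      ≡⟨ cong₂ _+_ (sum-blockThenZero pB) (sum-φ v) ⟩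
  sum B + sum (0 ∷ r)                    ≡⟨ sum-++ B (0 ∷ r) ⟨
  sum (B ++ 0 ∷ r)                       ∎
sum-φ (lastBlock pB) = trans (cong sum (φ-lastBlock pB)) (sum-blockAtEnd pB)

Full : List ℕ → List ℕ → ℕ → Set
Full δ d k = nth d k ≡ suc (nth δ k)

LeftOfFull : ℕ → List ℕ → List ℕ → Set
LeftOfFull p δ d = ∀ k → k < length δ → Full δ d k → nth (p ∷ d) k ≢ 0

RightOfFull : List ℕ → List ℕ → Set
RightOfFull δ e = ∀ k → k < length δ → Full δ e k → nth e (suc k) ≢ 0

Fits-nth : ∀ {δ d} → Fits δ d → ∀ k → nth d k ≤ suc (nth δ k)
Fits-nth []      k       = z≤n
Fits-nth (r ∷ _) zero    = r
Fits-nth (_ ∷ f) (suc k) = Fits-nth f k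

Fits-full : ∀ {δ d} → Fits δ d → ∀ k → nth δ k < nth d k → Full δ d k
Fits-full f k lt = ≤-antisym (Fits-nth f k) lt

lookup≡nth : ∀ δ (i : Fin (length δ)) → lookup δ i ≡ nth δ (toℕ i)
lookup≡nth (_ ∷ _) fzero    = refl
lookup≡nth (_ ∷ δ) (fsuc i) = lookup≡nth δ i

Star-preserves : ∀ {A : Set} {R : A → A → Set} {P : A → Set} → P Respects R → P Respects Star R
Star-preserves {P = P} step = fold (λ x y → P x → P y) (λ r k → k ∘ step r) id

Star-reflects : ∀ {A : Set} {R : A → A → Set} {P : A → Set} →
  (∀ {x y} → R x y → P y → P x) → ∀ {x y} → Star R x y → P y → P x
Star-reflects {P = P} step = fold (λ x y → P y → P x) (λ r k → step r ∘ k) id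

module _ {δ : List ℕ} where

  ∈⌊⌋⇒< : ∀ d {i j} → _∈_ {δ} (i , j) (⌊_⌋ {δ} d) → toℕ j < nth d (toℕ i)
  ∈⌊⌋⇒< _ = <ᵇ⇒< _ _ ∘ Equivalence.from T-≡

  <⇒∈⌊⌋ : ∀ d {i j} → toℕ j < nth d (toℕ i) → _∈_ {δ} (i , j) (⌊_⌋ {δ} d)
  <⇒∈⌊⌋ _ = Equivalence.to T-≡ ∘ <⇒<ᵇ

  ∈⌈⌉⇒≤ : ∀ e {i j} → _∈_ {δ} (i , j) (⌈_⌉ {δ} e) →
    suc (nth δ (toℕ i)) ∸ nth e (toℕ i) ≤ toℕ j
  ∈⌈⌉⇒≤ e {i} {j} =
    subst (λ g → suc g ∸ nth e (toℕ i) ≤ toℕ j) (lookup≡nth δ i) ∘ ≤ᵇ⇒≤ _ _ ∘ Equivalence.from T-≡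

  ≤⇒∈⌈⌉ : ∀ e {i j} → suc (nth δ (toℕ i)) ∸ nth e (toℕ i) ≤ toℕ j →
    _∈_ {δ} (i , j) (⌈_⌉ {δ} e)
  ≤⇒∈⌈⌉ e {i} {j} =
    Equivalence.to T-≡ ∘ ≤⇒≤ᵇ ∘ subst (λ g → suc g ∸ nth e (toℕ i) ≤ toℕ j) (sym (lookup≡nth δ i))

  module Link {k : ℕ} (sk : suc k < length δ) where
    lower upper : Fin (length δ)
    lower = fromℕ< (<-trans (n<1+n k) sk)
    upper = fromℕ< sk

    bottom top : Elem δ
    bottom = lower , fzero
    top    = upper , fromℕ (lookup δ upper)

    lower≡ : toℕ lower ≡ k
    lower≡ = toℕ-fromℕ< _

    upper≡ : toℕ upper ≡ suc k
    upper≡ = toℕ-fromℕ< sk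

    top-height : toℕ (proj₂ top) ≡ nth δ (suc k)
    top-height = trans (toℕ-fromℕ _) (trans (lookup≡nth δ upper) (cong (nth δ) upper≡))

    bottom⋖top : _⋖_ {δ} bottom top
    bottom⋖top = link (trans upper≡ (cong suc (sym lower≡))) refl (toℕ-fromℕ _)

  lowerIdeal⇒link : ∀ d → IsLowerIdeal δ (⌊_⌋ {δ} d) →
    ∀ k → suc k < length δ → Full δ d (suc k) → nth d k ≢ 0
  lowerIdeal⇒link d ideal k sk full dk≡0 = <-irrefl (sym dk≡0) (subst (λ i → 0 < nth d i) lower≡ bottom∈)
    where
      open Link sk
      top∈ : _∈_ {δ} top (⌊_⌋ {δ} d)
      top∈ = <⇒∈⌊⌋ d (subst₂ _<_ (sym top-height) (sym (trans (cong (nth d) upper≡) full)) ≤-refl)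
      bottom∈ : 0 < nth d (toℕ lower)
      bottom∈ = ∈⌊⌋⇒< d (ideal top bottom (bottom⋖top ◅ ε) top∈)

  leftOfFull⇒lowerIdeal : ∀ {p d} → Fits δ d → LeftOfFull p δ d → IsLowerIdeal δ (⌊_⌋ {δ} d)
  leftOfFull⇒lowerIdeal {d = d} f left _ _ y≤x = Star-reflects step y≤x
    where
      step : ∀ {a b} → _⋖_ {δ} a b → _∈_ {δ} b (⌊_⌋ {δ} d) → _∈_ {δ} a (⌊_⌋ {δ} d)
      step (chain j′≡) b∈ = <⇒∈⌊⌋ d (<-trans (n<1+n _) (subst (_< _) j′≡ (∈⌊⌋⇒< d b∈)))
      step (link {i} {i′} i′≡ j≡0 j′≡) b∈ = <⇒∈⌊⌋ d (subst (_< _) (sym j≡0) (n≢0⇒n>0 di≢0))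
        where
          full : Full δ d (toℕ i′)
          full = Fits-full f (toℕ i′) (subst (_< _) (trans j′≡ (lookup≡nth δ i′)) (∈⌊⌋⇒< d b∈))
          di≢0 : nth d (toℕ i) ≢ 0
          di≢0 = left (suc (toℕ i)) (subst (_< length δ) i′≡ (toℕ<n i′)) (subst (Full δ d) i′≡ full)

  filter⇒link : ∀ e → IsFilter δ (⌈_⌉ {δ} e) →
    ∀ k → suc k < length δ → Full δ e k → nth e (suc k) ≢ 0
  filter⇒link e filter k sk full ek≡0 = <-irrefl refl (subst (_≤ toℕ (proj₂ top)) ≡suc (∈⌈⌉⇒≤ e top∈))
    where
      open Link sk
      bottom∈ : _∈_ {δ} bottom (⌈_⌉ {δ} e)
      bottom∈ = ≤⇒∈⌈⌉ e (≤-reflexive (trans (cong₂ (λ a b → suc (nth δ a) ∸ nth e b) lower≡ lower≡)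
                  (trans (cong (suc (nth δ k) ∸_) full) (n∸n≡0 (suc (nth δ k))))))
      top∈ : _∈_ {δ} top (⌈_⌉ {δ} e)
      top∈ = filter bottom top (bottom⋖top ◅ ε) bottom∈
      ≡suc : suc (nth δ (toℕ upper)) ∸ nth e (toℕ upper) ≡ suc (toℕ (proj₂ top))
      ≡suc = trans (cong (λ i → suc (nth δ i) ∸ nth e i) upper≡)
               (trans (cong (suc (nth δ (suc k)) ∸_) ek≡0) (cong suc (sym top-height)))

  rightOfFull⇒filter : ∀ {e} → Fits δ e → RightOfFull δ e → IsFilter δ (⌈_⌉ {δ} e)
  rightOfFull⇒filter {e} f right _ _ = Star-preserves step
    where
      suc∸≤ : ∀ a {b} → b ≢ 0 → suc a ∸ b ≤ a
      suc∸≤ a {zero}  b≢0 = ⊥-elim (b≢0 refl)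
      suc∸≤ a {suc b} _   = m∸n≤m a b
      step : ∀ {a b} → _⋖_ {δ} a b → _∈_ {δ} a (⌈_⌉ {δ} e) → _∈_ {δ} b (⌈_⌉ {δ} e)
      step (chain j′≡) a∈ = ≤⇒∈⌈⌉ e (subst (_ ≤_) (sym j′≡) (m≤n⇒m≤1+n (∈⌈⌉⇒≤ e a∈)))
      step (link {i} {i′} i′≡ j≡0 j′≡) a∈ =
        ≤⇒∈⌈⌉ e (subst (_ ≤_) (sym (trans j′≡ (lookup≡nth δ i′))) (suc∸≤ _ ei′≢0))
        where
          full : Full δ e (toℕ i)
          full = Fits-full f (toℕ i) (m∸n≡0⇒m≤n (n≤0⇒n≡0 (subst (_ ≤_) j≡0 (∈⌈⌉⇒≤ e a∈))))
          ei′≢0 : nth e (toℕ i′) ≢ 0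
          ei′≢0 = subst (λ k → nth e k ≢ 0) (sym i′≡) (right (toℕ i) (toℕ<n i) full)

composition-positive : ∀ {δ} → IsComposition δ → Positive δ
composition-positive {δ} (_ , pos) = positive δ pos
  where
    positive : ∀ δ → (∀ k → k < length δ → 1 ≤ nth δ k) → Positive δ
    positive []      _   = []
    positive (_ ∷ δ) pos = pos 0 (s≤s z≤n) ∷ positive δ (λ k k< → pos (suc k) (s≤s k<))

IdealSeq⇒Fits : ∀ {p δ} d → IdealSeq p δ d → Fits δ d
IdealSeq⇒Fits {δ = []}    []      _                  = []
IdealSeq⇒Fits {δ = _ ∷ _} (_ ∷ d) ((_ , y≤ , _) , h) = y≤ ∷ IdealSeq⇒Fits d h

IdealSeq⇒leftOfFull : ∀ {p δ} d → IdealSeq p δ d → LeftOfFull p δ d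
IdealSeq⇒leftOfFull {δ = []}    []      _                 _       ()
IdealSeq⇒leftOfFull {δ = _ ∷ _} (_ ∷ _) ((_ , _ , left) , _) zero    _        = left
IdealSeq⇒leftOfFull {δ = _ ∷ _} (_ ∷ d) (_ , h)           (suc k) (s≤s k<) = IdealSeq⇒leftOfFull d h k k<

leftOfFull⇒IdealSeq : ∀ {p δ d} → Positive δ → Fits δ d → LeftOfFull p δ d → IdealSeq p δ d
leftOfFull⇒IdealSeq []          []         _    = tt
leftOfFull⇒IdealSeq (0<g ∷ pos) (y≤ ∷ fits) left =
  (0<g , y≤ , left 0 (s≤s z≤n)) , leftOfFull⇒IdealSeq pos fits (λ k k< → left (suc k) (s≤s k<))

IdealSeq⇒head≤ : ∀ {δ} d → IdealSeq 0 δ d → nth d 0 ≤ nth δ 0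
IdealSeq⇒head≤ {[]}    []      _       = z≤n
IdealSeq⇒head≤ {_ ∷ _} (_ ∷ _) (s , _) = Slot-zeroNeighbour s

headOr0≡nth0 : ∀ e → headOr 0 e ≡ nth e 0
headOr0≡nth0 []      = refl
headOr0≡nth0 (_ ∷ _) = refl

FilterSeq⇒Fits : ∀ {m δ} e → FilterSeq m δ e → Fits δ e
FilterSeq⇒Fits {δ = []}    []      _                  = []
FilterSeq⇒Fits {δ = _ ∷ _} (_ ∷ e) ((_ , y≤ , _) , h) = y≤ ∷ FilterSeq⇒Fits e h

FilterSeq⇒rightOfFull : ∀ {δ} e → FilterSeq 0 δ e → RightOfFull δ e
FilterSeq⇒rightOfFull {[]}    []      _                     _       ()
FilterSeq⇒rightOfFull {_ ∷ _} (_ ∷ e) ((_ , _ , right) , _) zero    _ full =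
  subst (_≢ 0) (headOr0≡nth0 e) (right full)
FilterSeq⇒rightOfFull {_ ∷ _} (_ ∷ e) (_ , h)               (suc k) (s≤s k<) = FilterSeq⇒rightOfFull e h k k<

rightOfFull⇒FilterSeq : ∀ {δ e} → Positive δ → Fits δ e → RightOfFull δ e → FilterSeq 0 δ e
rightOfFull⇒FilterSeq []          []                  _     = tt
rightOfFull⇒FilterSeq (0<g ∷ pos) (_∷_ {xs = e} y≤ fits) right =
  (0<g , y≤ , subst (_≢ 0) (sym (headOr0≡nth0 e)) ∘ right 0 (s≤s z≤n)) ,
  rightOfFull⇒FilterSeq pos fits (λ k k< → right (suc k) (s≤s k<))

FilterSeq⇒last≤ : ∀ {δ} e → FilterSeq 0 δ e → nth e (length δ ∸ 1) ≤ nth δ (length δ ∸ 1)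
FilterSeq⇒last≤ {[]}        []       _       = z≤n
FilterSeq⇒last≤ {_ ∷ []}    (_ ∷ []) (s , _) = Slot-zeroNeighbour s
FilterSeq⇒last≤ {_ ∷ _ ∷ _} (_ ∷ e)  (_ , h) = FilterSeq⇒last≤ e h

module _ {δ : List ℕ} (comp : IsComposition δ) where

  restrictedIdeal⇒IdealSeq : ∀ {d} → RestrictedIdeal δ d → IdealSeq 0 δ d
  restrictedIdeal⇒IdealSeq {d} (fits , ideal , d₀≤ , _) =
    leftOfFull⇒IdealSeq (composition-positive comp) fits left
    where
      left : LeftOfFull 0 δ d
      left zero    _  full _ = <-irrefl refl (subst (_≤ nth δ 0) full d₀≤)
      left (suc k) sk full   = lowerIdeal⇒link d ideal k sk full

  restrictedFilter⇒FilterSeq : ∀ {e} → RestrictedFilter δ e → FilterSeq 0 δ e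
  restrictedFilter⇒FilterSeq {e} (fits , filter , _ , eℓ≤) =
    rightOfFull⇒FilterSeq (composition-positive comp) fits right
    where
      right : RightOfFull δ e
      right k k< full with suc k <? length δ
      ... | yes sk = filter⇒link e filter k sk full
      ... | no  sk≮ =
        ⊥-elim (<-irrefl refl (subst (_≤ nth δ k) full (subst (λ i → nth e i ≤ nth δ i) ℓ∸1≡k eℓ≤)))
        where
          ℓ∸1≡k : length δ ∸ 1 ≡ k
          ℓ∸1≡k = cong (_∸ 1) (≤-antisym (≮⇒≥ sk≮) k<)

restrictedIdeal-last : ∀ {δ d} → RestrictedIdeal δ d → LastNot1 d
restrictedIdeal-last {d = d} (fits , _ , _ , dℓ≢1) =
  Equivalence.from (LastNot1⇔nth d) (subst (λ ℓ → nth d (ℓ ∸ 1) ≢ 1) (sym (Pointwise-length fits)) dℓ≢1)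

IdealSeq⇒restrictedIdeal : ∀ {δ d} → IdealSeq 0 δ d → LastNot1 d → RestrictedIdeal δ d
IdealSeq⇒restrictedIdeal {δ} {d} h last =
  fits , leftOfFull⇒lowerIdeal fits (IdealSeq⇒leftOfFull d h) , IdealSeq⇒head≤ d h ,
  subst (λ ℓ → nth d (ℓ ∸ 1) ≢ 1) (Pointwise-length fits) (Equivalence.to (LastNot1⇔nth d) last)
  where
    fits : Fits δ d
    fits = IdealSeq⇒Fits d h

FilterSeq⇒restrictedFilter : ∀ {δ e} → FilterSeq 0 δ e → HeadNot1 e → RestrictedFilter δ e
FilterSeq⇒restrictedFilter {δ} {e} h head =
  fits , rightOfFull⇒filter fits (FilterSeq⇒rightOfFull e h) , head , FilterSeq⇒last≤ e h
  where
    fits : Fits δ e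
    fits = FilterSeq⇒Fits e h

count : ℕ → (ℕ → Bool) → ℕ
count zero    P = 0
count (suc n) P = if P 0 then suc (count n (P ∘ suc)) else count n (P ∘ suc)

length-filterᵇ-tabulate : ∀ {A : Set} n (g : Fin n → A) (Q : A → Bool) (P : ℕ → Bool) →
  (∀ i → Q (g i) ≡ P (toℕ i)) → length (filterᵇ Q (tabulate g)) ≡ count n P
length-filterᵇ-tabulate zero    g Q P _  = refl
length-filterᵇ-tabulate (suc n) g Q P eq with Q (g fzero) | P 0 | eq fzero
... | true  | .true  | refl = cong suc (length-filterᵇ-tabulate n (g ∘ fsuc) Q (P ∘ suc) (eq ∘ fsuc))
... | false | .false | refl = length-filterᵇ-tabulate n (g ∘ fsuc) Q (P ∘ suc) (eq ∘ fsuc)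

count-cong : ∀ n {P Q} → (∀ k → P k ≡ Q k) → count n P ≡ count n Q
count-cong zero    _  = refl
count-cong (suc n) {P} {Q} eq rewrite eq 0 = cong (λ c → if Q 0 then suc c else c) (count-cong n (eq ∘ suc))

count-< : ∀ n x → x ≤ n → count n (_<ᵇ x) ≡ x
count-< zero    zero    _        = refl
count-< (suc n) zero    _        = count-< n zero z≤n
count-< (suc n) (suc x) (s≤s x≤n) = cong suc (count-< n x x≤n)

count-≤ : ∀ n c → count n (c ≤ᵇ_) ≡ n ∸ c
count-≤ zero    zero    = refl
count-≤ zero    (suc _) = refl
count-≤ (suc n) zero    = cong suc (count-≤ n zero)
count-≤ (suc n) (suc c) = trans (count-cong n (<ᵇ-suc c)) (count-≤ n c)
  where
    <ᵇ-suc : ∀ c k → (c <ᵇ suc k) ≡ (c ≤ᵇ k)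
    <ᵇ-suc zero    _ = refl
    <ᵇ-suc (suc _) _ = refl

sum-chains : ∀ {δ d} (F : ℕ → ℕ → ℕ) → (∀ g x → x ≤ suc g → F g x ≡ x) → Fits δ d →
  sum (tabulate (λ i → F (lookup δ i) (nth d (toℕ i)))) ≡ sum d
sum-chains F F≡ []               = refl
sum-chains F F≡ (_∷_ {x = y} {y = g} y≤ fits) = cong₂ _+_ (F≡ g y y≤) (sum-chains F F≡ fits)

card-⌊⌋ : ∀ δ d → Fits δ d → card δ (⌊_⌋ {δ} d) ≡ sum d
card-⌊⌋ δ d fits =
  trans (cong sum (map-tabulate {n = length δ} id (λ i → chainCount (lookup δ i) (nth d (toℕ i)))))
        (sum-chains chainCount count-chain fits)
  where
    chainCount : ℕ → ℕ → ℕ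
    chainCount g x = length (filterᵇ (λ (j : Fin (suc g)) → toℕ j <ᵇ x) (allFin (suc g)))
    count-chain : ∀ g x → x ≤ suc g → chainCount g x ≡ x
    count-chain g x x≤ =
      trans (length-filterᵇ-tabulate (suc g) id _ (_<ᵇ x) (λ _ → refl)) (count-< (suc g) x x≤)

card-⌈⌉ : ∀ δ e → Fits δ e → card δ (⌈_⌉ {δ} e) ≡ sum e
card-⌈⌉ δ e fits =
  trans (cong sum (map-tabulate {n = length δ} id (λ i → chainCount (lookup δ i) (nth e (toℕ i)))))
        (sum-chains chainCount count-chain fits)
  where
    chainCount : ℕ → ℕ → ℕ
    chainCount g x = length (filterᵇ (λ (j : Fin (suc g)) → (suc g ∸ x) ≤ᵇ toℕ j) (allFin (suc g)))
    count-chain : ∀ g x → x ≤ suc g → chainCount g x ≡ x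
    count-chain g x x≤ = trans (length-filterᵇ-tabulate (suc g) id _ ((suc g ∸ x) ≤ᵇ_) (λ _ → refl))
      (trans (count-≤ (suc g) (suc g ∸ x)) (m∸[m∸n]≡n x≤))

theorem2p1 : (δ : List ℕ) → IsComposition δ →
    ((d : List ℕ) → RestrictedIdeal δ d → RestrictedFilter δ (φ d))
    × ((d₁ d₂ : List ℕ) → RestrictedIdeal δ d₁ → RestrictedIdeal δ d₂ → φ d₁ ≡ φ d₂ → d₁ ≡ d₂)
    × ((e : List ℕ) → RestrictedFilter δ e → ∃ (λ d → RestrictedIdeal δ d × φ d ≡ e))
    × ((d : List ℕ) → RestrictedIdeal δ d → card δ (⌈_⌉ {δ} (φ d)) ≡ card δ (⌊_⌋ {δ} d))
theorem2p1 δ comp = φ-restricted , φ-injective , φ-surjective , φ-card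
  where
    φ-restricted : (d : List ℕ) → RestrictedIdeal δ d → RestrictedFilter δ (φ d)
    φ-restricted d ri = FilterSeq⇒restrictedFilter
      (φ-FilterSeq (blocks d) (restrictedIdeal⇒IdealSeq comp ri)) (φ-headNot1 (blocks d) (restrictedIdeal-last ri))

    φ-injective : (d₁ d₂ : List ℕ) → RestrictedIdeal δ d₁ → RestrictedIdeal δ d₂ → φ d₁ ≡ φ d₂ → d₁ ≡ d₂
    φ-injective d₁ d₂ r₁ r₂ eq = begin
      d₁          ≡⟨ ψ-φ (blocks d₁) (restrictedIdeal-last r₁) ⟨
      ψ (φ d₁)    ≡⟨ cong ψ eq ⟩
      ψ (φ d₂)    ≡⟨ ψ-φ (blocks d₂) (restrictedIdeal-last r₂) ⟩
      d₂          ∎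

    φ-surjective : (e : List ℕ) → RestrictedFilter δ e → ∃ (λ d → RestrictedIdeal δ d × φ d ≡ e)
    φ-surjective e rf@(_ , _ , e₀≢1 , _) =
      ψ e ,
      IdealSeq⇒restrictedIdeal (ψ-IdealSeq (pieces e) e₀≢1 (restrictedFilter⇒FilterSeq comp rf))
                               (ψ-last (pieces e) e₀≢1) ,
      φ-ψ (pieces e) e₀≢1

    φ-card : (d : List ℕ) → RestrictedIdeal δ d → card δ (⌈_⌉ {δ} (φ d)) ≡ card δ (⌊_⌋ {δ} d)
    φ-card d ri@(fits , _) = begin
      card δ (⌈_⌉ {δ} (φ d))   ≡⟨ card-⌈⌉ δ (φ d) (proj₁ (φ-restricted d ri)) ⟩
      sum (φ d)                ≡⟨ sum-φ (blocks d) ⟩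
      sum d                    ≡⟨ card-⌊⌋ δ d fits ⟨
      card δ (⌊_⌋ {δ} d)       ∎
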